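{- Let $a,b,q$ be indeterminates and $\mu$ a partition of length $l\ge1$. Then \[ \sum_{c\in C_{\mu}}\prod_{i=1}^{l}\frac{a^{c_i}q^{[c_{i-1}]}-b^{c_i}}{1-q^{[c_i]}}=\sum_{c\in C_{\mu}}\prod_{i=1}^{l}\frac{a^{c_i}q^{(l-i)c_i}-b^{c_i}}{1-q^{[c_i]}}. \]
   Context: $C_\mu$ is the set of distinct sequences $c=(c_1,\ldots,c_l)$ obtained by permuting the parts of $\mu$; $[c_i]=c_1+\cdots+c_i$ and $[c_0]=0$. -}

module Defs where

open import Level using (Level)
open import Data.Nat as ℕ using (ℕ; zero; suc; _≤_; _≥_)
open import Data.List using (List; []; _∷_; length)
open import Data.List.Relation.Unary.All using (All)
open import Data.List.Relation.Unary.Linked using (Linked)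
open import Algebra.Bundles using (CommutativeRing; Semiring)
import Algebra.Definitions.RawSemiring as RS

record IsPartition (μ : List ℕ) : Set where
  field
    positive   : All (λ x → 1 ≤ x) μ
    decreasing : Linked _≥_ μ

module Terms {c ℓ : Level} (R : CommutativeRing c ℓ) where
  open CommutativeRing R
  open RS (Semiring.rawSemiring (CommutativeRing.semiring R)) using (_^_)

  -- 'inv k' plays the role of 1/(1 - q^k).
  -- lhsProd a b q inv s c = ∏_i (a^{c_i} q^{s+[c_{i-1}]} - b^{c_i}) / (1 - q^{s+[c_i]})
  lhsProd : Carrier → Carrier → Carrier → (ℕ → Carrier) → ℕ → List ℕ → Carrier
  lhsProd a b q inv s [] = 1#
  lhsProd a b q inv s (x ∷ xs) =
    ((a ^ x) * (q ^ s) - (b ^ x)) * inv (s ℕ.+ x) * lhsProd a b q inv (s ℕ.+ x) xs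

  -- rhsProd: factor i is (a^{c_i} q^{(l-i) c_i} - b^{c_i}) / (1 - q^{[c_i]});
  -- l - i = number of parts after c_i = length xs.
  rhsProd : Carrier → Carrier → Carrier → (ℕ → Carrier) → ℕ → List ℕ → Carrier
  rhsProd a b q inv s [] = 1#
  rhsProd a b q inv s (x ∷ xs) =
    ((a ^ x) * (q ^ (length xs ℕ.* x)) - (b ^ x)) * inv (s ℕ.+ x) * rhsProd a b q inv (s ℕ.+ x) xs

  sumOver : (List ℕ → Carrier) → List (List ℕ) → Carrier
  sumOver f [] = 0#
  sumOver f (c ∷ cs) = f c + sumOver f cs

{-# OPTIONS --safe #-}
module Submission where

open import Defs
open import Level using (Level)
open import Data.Nat using (ℕ; _≤_)
open import Data.List using (List; length)
open import Data.Nat.ListAction using (sum)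
open import Data.List.Membership.Propositional using (_∈_)
open import Data.List.Relation.Unary.Unique.Propositional using (Unique)
open import Data.List.Relation.Binary.Permutation.Propositional using (_↭_)
open import Function.Bundles using (_⇔_)
open import Algebra.Bundles using (CommutativeRing; Semiring)
import Algebra.Definitions.RawSemiring as RS

open import Data.Nat as ℕ using (zero; suc)
import Data.Nat.Properties as ℕ
open import Data.Integer as ℤ using (ℤ; -[1+_]; _⊖_)
import Data.Integer.Properties as ℤ
import Data.Sign as Sign
open import Data.Product using (_×_; _,_)
open import Data.Maybe using (Maybe; just; nothing)
open import Data.Empty using (⊥)
open import Data.List using ([]; _∷_; [_]; _∷ʳ_; map; reverse; upTo)
open import Data.List.Properties using (reverse-involutive; reverse-injective; length-++; unfold-reverse)
open import Data.Nat.ListAction.Properties using (sum-↭)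
open import Data.List.Membership.Propositional.Properties using (∈-map⁺; ∈-map⁻; ∈-upTo⁺)
open import Data.List.Relation.Unary.Any using (here; there)
open import Data.List.Relation.Unary.All as All using (All)
open import Data.List.Relation.Unary.AllPairs using ([]; _∷_)
import Data.List.Relation.Unary.Unique.Propositional.Properties as Unique
open import Data.List.Relation.Binary.Permutation.Propositional using (↭-refl; ↭-sym; ↭-trans; prep; swap)
open import Data.List.Relation.Binary.Permutation.Propositional.Properties
  using (drop-∷; ∈-resp-↭; ↭-empty-inv; ↭-length; ↭-reverse)
open import Relation.Nullary using (Dec; yes; no; contradiction; _×-dec_)
open import Relation.Binary.Definitions using (DecidableEquality)
open import Relation.Binary.PropositionalEquality as ≡ using (_≡_; _≢_)
open import Function using (_∘_)
open import Function.Bundles using (mk⇔; Equivalence)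
import Algebra.Solver.Ring as RingSolver
open import Algebra.Solver.Ring.AlmostCommutativeRing using (_-Raw-AlmostCommutative⟶_; fromCommutativeRing)

-- Read every arrangement from its last part z. Both last factors have the denominator 1 - q^{|M|},
-- where |M| is the sum of the multiset M of parts, so the two sums L(a, M) and R(a, M) satisfy
--   L(a, M) = Σ_z (a^z q^{|M|-z} - b^z) L(a, M - z) / (1 - q^{|M|}),
--   R(a, M) = Σ_z (a^z - b^z) R(aq, M - z) / (1 - q^{|M|}),
-- z ranging over the distinct parts; the shift a ↦ aq absorbs the exponent (l - i) c_i. By induction on
-- the number of parts it suffices to show Σ_z (a^z q^{|M|-z} - b^z) L(a, M - z) = Σ_z (a^z - b^z) L(aq, M - z).
-- Expanding both sides once more over a second part w (the left side with this very identity, one size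
-- down), the (z, w) terms differ by (a^z b^w - a^w b^z) L(aq, M - z - w), which is antisymmetric in
-- (z, w) and so sums to zero.

-- The ring solver needs decidable equality of coefficients, so they are taken in ℤ.
module IntegerCoefficients {c ℓ} (R : CommutativeRing c ℓ) where
  open CommutativeRing R
  open import Algebra.Properties.Ring ring using (-‿distribˡ-*; -‿distribʳ-*)
  open import Algebra.Properties.AbelianGroup +-abelianGroup using (⁻¹-∙-comm; xyx⁻¹≈y)
  open import Algebra.Properties.Group +-group using (⁻¹-involutive; ε⁻¹≈ε)
  open import Algebra.Properties.Semiring.Mult.TCOptimised semiring
    using (1+×; ×-homo-+; ×1-homo-*) renaming (_×_ to _·_)
  open import Relation.Binary.Reasoning.Setoid setoid

  fromℕ : ℕ → Carrier
  fromℕ n = n · 1#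

  fromℤ : ℤ → Carrier
  fromℤ (ℤ.+ n)  = fromℕ n
  fromℤ -[1+ n ] = - fromℕ (suc n)

  private
    x+y-[x+z]≈y-z : ∀ x y z → (x + y) - (x + z) ≈ y - z
    x+y-[x+z]≈y-z x y z = begin
      (x + y) - (x + z)    ≈⟨ +-congˡ (⁻¹-∙-comm x z) ⟨
      (x + y) + (- x - z)  ≈⟨ +-assoc (x + y) (- x) (- z) ⟨
      (x + y - x) - z      ≈⟨ +-congʳ (xyx⁻¹≈y x y) ⟩
      y - z                ∎

    fromℤ-+◃ : ∀ n → fromℤ (Sign.+ ℤ.◃ n) ≡ fromℕ n
    fromℤ-+◃ zero    = ≡.refl
    fromℤ-+◃ (suc n) = ≡.refl

    fromℤ--◃ : ∀ n → fromℤ (Sign.- ℤ.◃ n) ≈ - fromℕ n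
    fromℤ--◃ zero    = sym ε⁻¹≈ε
    fromℤ--◃ (suc n) = refl

  fromℤ-⊖ : ∀ m n → fromℤ (m ⊖ n) ≈ fromℕ m - fromℕ n
  fromℤ-⊖ zero    zero    = sym (-‿inverseʳ 0#)
  fromℤ-⊖ zero    (suc n) = sym (+-identityˡ _)
  fromℤ-⊖ (suc m) zero    = sym (trans (+-congˡ ε⁻¹≈ε) (+-identityʳ _))
  fromℤ-⊖ (suc m) (suc n) = begin
    fromℤ (suc m ⊖ suc n)            ≡⟨ ≡.cong fromℤ (ℤ.[1+m]⊖[1+n]≡m⊖n m n) ⟩
    fromℤ (m ⊖ n)                    ≈⟨ fromℤ-⊖ m n ⟩
    fromℕ m - fromℕ n                ≈⟨ x+y-[x+z]≈y-z 1# (fromℕ m) (fromℕ n) ⟨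
    (1# + fromℕ m) - (1# + fromℕ n)  ≈⟨ +-cong (1+× m 1#) (-‿cong (1+× n 1#)) ⟨
    fromℕ (suc m) - fromℕ (suc n)    ∎

  fromℤ-+ : ∀ i j → fromℤ (i ℤ.+ j) ≈ fromℤ i + fromℤ j
  fromℤ-+ (ℤ.+ m)  (ℤ.+ n)  = ×-homo-+ 1# m n
  fromℤ-+ (ℤ.+ m)  -[1+ n ] = fromℤ-⊖ m (suc n)
  fromℤ-+ -[1+ m ] (ℤ.+ n)  = trans (fromℤ-⊖ n (suc m)) (+-comm _ _)
  fromℤ-+ -[1+ m ] -[1+ n ] = begin
    - fromℕ (suc (suc (m ℕ.+ n)))      ≡⟨ ≡.cong (λ k → - fromℕ (suc k)) (ℕ.+-suc m n) ⟨
    - fromℕ (suc m ℕ.+ suc n)          ≈⟨ -‿cong (×-homo-+ 1# (suc m) (suc n)) ⟩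
    - (fromℕ (suc m) + fromℕ (suc n))  ≈⟨ ⁻¹-∙-comm _ _ ⟨
    - fromℕ (suc m) - fromℕ (suc n)    ∎

  fromℤ-‿- : ∀ i → fromℤ (ℤ.- i) ≈ - fromℤ i
  fromℤ-‿- (ℤ.+ zero)  = sym ε⁻¹≈ε
  fromℤ-‿- (ℤ.+ suc n) = refl
  fromℤ-‿- -[1+ n ]    = sym (⁻¹-involutive _)

  fromℤ-* : ∀ i j → fromℤ (i ℤ.* j) ≈ fromℤ i * fromℤ j
  fromℤ-* (ℤ.+ m)  (ℤ.+ n)  = trans (reflexive (fromℤ-+◃ (m ℕ.* n))) (×1-homo-* m n)
  fromℤ-* (ℤ.+ m)  -[1+ n ] = begin
    fromℤ (Sign.- ℤ.◃ m ℕ.* suc n)       ≈⟨ fromℤ--◃ (m ℕ.* suc n) ⟩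
    - fromℕ (m ℕ.* suc n)                ≈⟨ -‿cong (×1-homo-* m (suc n)) ⟩
    - (fromℕ m * fromℕ (suc n))          ≈⟨ -‿distribʳ-* _ _ ⟩
    fromℕ m * - fromℕ (suc n)            ∎
  fromℤ-* -[1+ m ] (ℤ.+ n)  = begin
    fromℤ (Sign.- ℤ.◃ suc m ℕ.* n)       ≈⟨ fromℤ--◃ (suc m ℕ.* n) ⟩
    - fromℕ (suc m ℕ.* n)                ≈⟨ -‿cong (×1-homo-* (suc m) n) ⟩
    - (fromℕ (suc m) * fromℕ n)          ≈⟨ -‿distribˡ-* _ _ ⟩
    - fromℕ (suc m) * fromℕ n            ∎
  fromℤ-* -[1+ m ] -[1+ n ] = begin
    fromℕ (suc m ℕ.* suc n)              ≈⟨ ×1-homo-* (suc m) (suc n) ⟩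
    fromℕ (suc m) * fromℕ (suc n)        ≈⟨ *-congʳ (⁻¹-involutive _) ⟨
    - - fromℕ (suc m) * fromℕ (suc n)    ≈⟨ -‿distribˡ-* _ _ ⟨
    - (- fromℕ (suc m) * fromℕ (suc n))  ≈⟨ -‿distribʳ-* _ _ ⟩
    - fromℕ (suc m) * - fromℕ (suc n)    ∎

  fromℤ-homomorphism : ℤ.+-*-rawRing -Raw-AlmostCommutative⟶ fromCommutativeRing R
  fromℤ-homomorphism = record
    { ⟦_⟧    = fromℤ
    ; +-homo = fromℤ-+
    ; *-homo = fromℤ-*
    ; -‿homo = fromℤ-‿-
    ; 0-homo = refl
    ; 1-homo = refl
    }

  fromℤ-≈? : ∀ i j → Maybe (fromℤ i ≈ fromℤ j)
  fromℤ-≈? i j with i ℤ.≟ j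
  ... | yes ≡.refl = just refl
  ... | no _       = nothing

  open RingSolver ℤ.+-*-rawRing (fromCommutativeRing R) fromℤ-homomorphism fromℤ-≈? public


module Multisets {A : Set} (_≟_ : DecidableEquality A) where
  open import Data.List.Membership.DecPropositional _≟_ public using (_∈?_)

  remove : A → List A → List A
  remove z []       = []
  remove z (x ∷ xs) with z ≟ x
  ... | yes _ = xs
  ... | no  _ = x ∷ remove z xs

  remove-head : ∀ x xs → remove x (x ∷ xs) ≡ xs
  remove-head x xs with x ≟ x
  ... | yes _  = ≡.refl
  ... | no x≢x = contradiction ≡.refl x≢x

  remove-skip : ∀ {z x} xs → z ≢ x → remove z (x ∷ xs) ≡ x ∷ remove z xs
  remove-skip {z} {x} xs z≢x with z ≟ x
  ... | yes z≡x = contradiction z≡x z≢x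
  ... | no _    = ≡.refl

  ↭-remove : ∀ {z xs} → z ∈ xs → xs ↭ z ∷ remove z xs
  ↭-remove {z} {x ∷ xs} z∈ with z ≟ x
  ↭-remove {z} {x ∷ xs} z∈         | yes ≡.refl = ↭-refl
  ↭-remove {z} {x ∷ xs} (here z≡x) | no z≢x     = contradiction z≡x z≢x
  ↭-remove {z} {x ∷ xs} (there z∈) | no _       = ↭-trans (prep x (↭-remove z∈)) (swap x z ↭-refl)

  length-remove : ∀ {z xs n} → z ∈ xs → length xs ≡ suc n → length (remove z xs) ≡ n
  length-remove z∈ |xs| = ℕ.suc-injective (≡.trans (≡.sym (↭-length (↭-remove z∈))) |xs|)

  ∈-remove⁻ : ∀ {y z} xs → y ∈ remove z xs → y ∈ xs
  ∈-remove⁻ {y} {z} (x ∷ xs) y∈ with z ≟ x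
  ∈-remove⁻ (x ∷ xs) y∈         | yes _ = there y∈
  ∈-remove⁻ (x ∷ xs) (here y≡x) | no _  = here y≡x
  ∈-remove⁻ (x ∷ xs) (there y∈) | no _  = there (∈-remove⁻ xs y∈)

  ∈-remove⁺ : ∀ {y z xs} → y ≢ z → y ∈ xs → y ∈ remove z xs
  ∈-remove⁺ {y} {z} {x ∷ xs} y≢z y∈ with z ≟ x
  ∈-remove⁺ y≢z (here ≡.refl) | yes ≡.refl = contradiction ≡.refl y≢z
  ∈-remove⁺ y≢z (there y∈)    | yes _      = y∈
  ∈-remove⁺ y≢z (here y≡x)    | no _       = here y≡x
  ∈-remove⁺ y≢z (there y∈)    | no _       = there (∈-remove⁺ y≢z y∈)

  ∈-remove-swap : ∀ {z w xs} → z ∈ xs × w ∈ remove z xs → w ∈ xs × z ∈ remove w xs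
  ∈-remove-swap {z} {w} {xs} (z∈ , w∈) with z ≟ w
  ... | yes ≡.refl = z∈ , w∈
  ... | no z≢w     = ∈-remove⁻ xs w∈ , ∈-remove⁺ z≢w z∈

  remove-comm : ∀ z w xs → remove z (remove w xs) ≡ remove w (remove z xs)
  remove-comm z w []       = ≡.refl
  remove-comm z w (x ∷ xs) with z ≟ x | w ≟ x
  ... | yes ≡.refl | yes ≡.refl = ≡.refl
  ... | yes ≡.refl | no _       = remove-head z (remove w xs)
  ... | no _       | yes ≡.refl = ≡.sym (remove-head w (remove z xs))
  ... | no z≢x     | no w≢x
    rewrite remove-skip (remove w xs) z≢x | remove-skip (remove z xs) w≢x
    = ≡.cong (x ∷_) (remove-comm z w xs)

  derivative : A → List (List A) → List (List A)
  derivative z []             = []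
  derivative z ([] ∷ C)       = derivative z C
  derivative z ((x ∷ w) ∷ C) with z ≟ x
  ... | yes _ = w ∷ derivative z C
  ... | no  _ = derivative z C

  ∈-derivative⁻ : ∀ {z w} C → w ∈ derivative z C → z ∷ w ∈ C
  ∈-derivative⁻ ([] ∷ C) w∈ = there (∈-derivative⁻ C w∈)
  ∈-derivative⁻ {z} ((x ∷ r) ∷ C) w∈ with z ≟ x
  ∈-derivative⁻ ((x ∷ r) ∷ C) (here ≡.refl) | yes ≡.refl = here ≡.refl
  ∈-derivative⁻ ((x ∷ r) ∷ C) (there w∈)    | yes _      = there (∈-derivative⁻ C w∈)
  ∈-derivative⁻ ((x ∷ r) ∷ C) w∈            | no _       = there (∈-derivative⁻ C w∈)

  ∈-derivative⁺ : ∀ {z w} C → z ∷ w ∈ C → w ∈ derivative z C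
  ∈-derivative⁺ ([] ∷ C) (there w∈) = ∈-derivative⁺ C w∈
  ∈-derivative⁺ {z} ((x ∷ r) ∷ C) w∈ with z ≟ x
  ∈-derivative⁺ ((x ∷ r) ∷ C) (here ≡.refl) | yes _   = here ≡.refl
  ∈-derivative⁺ ((x ∷ r) ∷ C) (there w∈)    | yes _   = there (∈-derivative⁺ C w∈)
  ∈-derivative⁺ ((x ∷ r) ∷ C) (here ≡.refl) | no z≢z = contradiction ≡.refl z≢z
  ∈-derivative⁺ ((x ∷ r) ∷ C) (there w∈)    | no _   = ∈-derivative⁺ C w∈

  derivative-unique : ∀ z {C} → Unique C → Unique (derivative z C)
  derivative-unique z {[]}          []        = []
  derivative-unique z {[] ∷ C}      (_ ∷ uC)  = derivative-unique z uC
  derivative-unique z {(x ∷ r) ∷ C} (r∉ ∷ uC) with z ≟ x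
  ... | yes ≡.refl = r∉derivative ∷ derivative-unique z uC
    where
    r∉derivative : All (r ≢_) (derivative z C)
    r∉derivative = All.tabulate λ w∈ r≡w →
      All.lookup r∉ (∈-derivative⁻ C w∈) (≡.cong (z ∷_) r≡w)
  ... | no _       = derivative-unique z uC

  record Arrangements (C : List (List A)) (μ : List A) : Set where
    field
      unique : Unique C
      ∈⇔↭    : ∀ w → (w ∈ C) ⇔ (w ↭ μ)

    ∈⇒↭ : ∀ {w} → w ∈ C → w ↭ μ
    ∈⇒↭ = Equivalence.to (∈⇔↭ _)

    ↭⇒∈ : ∀ {w} → w ↭ μ → w ∈ C
    ↭⇒∈ = Equivalence.from (∈⇔↭ _)

  arrangements-[] : ∀ {C} → Arrangements C [] → C ≡ [ [] ]
  arrangements-[] {[]}        arr with () ← Arrangements.↭⇒∈ arr ↭-refl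
  arrangements-[] {c ∷ []}    arr = ≡.cong [_] (↭-empty-inv (Arrangements.∈⇒↭ arr (here ≡.refl)))
  arrangements-[] {c ∷ d ∷ C} arr
    with ≡.refl ← ↭-empty-inv (Arrangements.∈⇒↭ arr (here ≡.refl))
       | ≡.refl ← ↭-empty-inv (Arrangements.∈⇒↭ arr (there (here ≡.refl)))
       | c∉ ∷ _ ← Arrangements.unique arr
    = contradiction ≡.refl (All.lookup c∉ (here ≡.refl))

  module _ {C μ} (arr : Arrangements C μ) where
    open Arrangements arr

    arrangements-derivative : ∀ {z} → z ∈ μ → Arrangements (derivative z C) (remove z μ)
    arrangements-derivative {z} z∈μ = record
      { unique = derivative-unique z unique
      ; ∈⇔↭    = λ w → mk⇔
          (λ w∈ → drop-∷ (↭-trans (∈⇒↭ (∈-derivative⁻ C w∈)) (↭-remove z∈μ)))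
          (λ w↭ → ∈-derivative⁺ C (↭⇒∈ (↭-trans (prep z w↭) (↭-sym (↭-remove z∈μ)))))
      }

    ∈-derivative⇒∈ : ∀ {z w} → w ∈ derivative z C → z ∈ μ
    ∈-derivative⇒∈ w∈ = ∈-resp-↭ (∈⇒↭ (∈-derivative⁻ C w∈)) (here ≡.refl)

    arrangements-reverse : Arrangements (map reverse C) μ
    arrangements-reverse = record
      { unique = Unique.map⁺ reverse-injective unique
      ; ∈⇔↭    = λ w → mk⇔ to (from w)
      }
      where
      to : ∀ {w} → w ∈ map reverse C → w ↭ μ
      to w∈ with c , c∈ , ≡.refl ← ∈-map⁻ reverse w∈ = ↭-trans (↭-reverse c) (∈⇒↭ c∈)

      from : ∀ w → w ↭ μ → w ∈ map reverse C
      from w w↭ = ≡.subst (_∈ map reverse C) (reverse-involutive w)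
                    (∈-map⁺ reverse (↭⇒∈ (↭-trans (↭-reverse w) w↭)))


module FiniteSums {c ℓ} (R : CommutativeRing c ℓ) where
  open CommutativeRing R
  open import Algebra.Properties.AbelianGroup +-abelianGroup using (⁻¹-∙-comm)
  open import Algebra.Properties.Group +-group using (ε⁻¹≈ε)
  open import Algebra.Properties.CommutativeSemigroup +-commutativeSemigroup using (interchange)
  open import Relation.Binary.Reasoning.Setoid setoid

  ∑ : ∀ {a} {A : Set a} → List A → (A → Carrier) → Carrier
  ∑ []       f = 0#
  ∑ (x ∷ xs) f = f x + ∑ xs f

  infix 5 ∑
  syntax ∑ U (λ z → e) = ∑[ z ∈ U ] e

  when : ∀ {p} {P : Set p} → Dec P → Carrier → Carrier
  when (yes _) x = x
  when (no _)  _ = 0#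

  module _ {p} {P : Set p} where

    when-cong : ∀ (d : Dec P) {x y} → (P → x ≈ y) → when d x ≈ when d y
    when-cong (yes holds) x≈y = x≈y holds
    when-cong (no _)      _   = refl

    when-0# : ∀ (d : Dec P) → when d 0# ≈ 0#
    when-0# (yes _) = refl
    when-0# (no _)  = refl

    when-+ : ∀ (d : Dec P) x y → when d (x + y) ≈ when d x + when d y
    when-+ (yes _) x y = refl
    when-+ (no _)  x y = sym (+-identityʳ 0#)

    when-‿- : ∀ (d : Dec P) x → when d (- x) ≈ - when d x
    when-‿- (yes _) x = refl
    when-‿- (no _)  x = sym ε⁻¹≈ε

    when-⇔ : ∀ {q} {Q : Set q} → P ⇔ Q → (d : Dec P) (e : Dec Q) {x : Carrier} → when d x ≡ when e x
    when-⇔ P⇔Q (yes _)  (yes _)  = ≡.refl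
    when-⇔ P⇔Q (no _)   (no _)   = ≡.refl
    when-⇔ P⇔Q (yes p′) (no ¬q) = contradiction (Equivalence.to P⇔Q p′) ¬q
    when-⇔ P⇔Q (no ¬p) (yes q′) = contradiction (Equivalence.from P⇔Q q′) ¬p

  module _ {a} {A : Set a} where

    ∑-cong-∈ : ∀ (U : List A) {f g : A → Carrier} → (∀ {z} → z ∈ U → f z ≈ g z) →
               ∑ U f ≈ ∑ U g
    ∑-cong-∈ []      f≈g = refl
    ∑-cong-∈ (z ∷ U) f≈g = +-cong (f≈g (here ≡.refl)) (∑-cong-∈ U (f≈g ∘ there))

    ∑-cong : ∀ (U : List A) {f g : A → Carrier} → (∀ z → f z ≈ g z) → ∑ U f ≈ ∑ U g
    ∑-cong U f≈g = ∑-cong-∈ U (λ {z} _ → f≈g z)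

    ∑-map : ∀ {b} {B : Set b} (g : B → A) (C : List B) (f : A → Carrier) →
            ∑ (map g C) f ≡ ∑ C (f ∘ g)
    ∑-map g []      f = ≡.refl
    ∑-map g (c ∷ C) f = ≡.cong (f (g c) +_) (∑-map g C f)

    ∑-zero : ∀ (U : List A) → ∑[ _ ∈ U ] 0# ≈ 0#
    ∑-zero []      = refl
    ∑-zero (z ∷ U) = trans (+-identityˡ _) (∑-zero U)

    ∑-distrib-+ : ∀ (U : List A) (f g : A → Carrier) → ∑[ z ∈ U ] (f z + g z) ≈ ∑ U f + ∑ U g
    ∑-distrib-+ []      f g = sym (+-identityˡ 0#)
    ∑-distrib-+ (z ∷ U) f g = trans (+-congˡ (∑-distrib-+ U f g)) (interchange _ _ _ _)

    ∑-distrib-‿- : ∀ (U : List A) (f : A → Carrier) → ∑[ z ∈ U ] (- f z) ≈ - ∑ U f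
    ∑-distrib-‿- []      f = sym ε⁻¹≈ε
    ∑-distrib-‿- (z ∷ U) f = trans (+-congˡ (∑-distrib-‿- U f)) (⁻¹-∙-comm _ _)

    *-distribʳ-∑ : ∀ (U : List A) (f : A → Carrier) x → ∑ U f * x ≈ ∑[ z ∈ U ] (f z * x)
    *-distribʳ-∑ []      f x = zeroˡ x
    *-distribʳ-∑ (z ∷ U) f x = trans (distribʳ x (f z) (∑ U f)) (+-congˡ (*-distribʳ-∑ U f x))

    ∑-δ : ∀ (_≟_ : DecidableEquality A) {U : List A} → Unique U → ∀ {x} → x ∈ U →
          (f : A → Carrier) → ∑[ z ∈ U ] when (z ≟ x) (f z) ≈ f x
    ∑-δ _≟_ {z ∷ U} (z∉U ∷ _) {x} x∈ f with z ≟ x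
    ... | yes ≡.refl = trans (+-congˡ (trans (∑-cong-∈ U off-diagonal) (∑-zero U))) (+-identityʳ _)
      where
      off-diagonal : ∀ {w} → w ∈ U → when (w ≟ z) (f w) ≈ 0#
      off-diagonal {w} w∈U with w ≟ z
      ... | yes ≡.refl = contradiction ≡.refl (All.lookup z∉U w∈U)
      ... | no _       = refl
    ∑-δ _≟_ {z ∷ U} _        (here ≡.refl) f | no z≢x = contradiction ≡.refl z≢x
    ∑-δ _≟_ {z ∷ U} (_ ∷ uU) (there x∈U)   f | no _   = trans (+-identityˡ _) (∑-δ _≟_ uU x∈U f)

    when-*-∑ : ∀ {p q} {P : Set p} {Q : A → Set q} (d : Dec P) (U : List A) (e : ∀ w → Dec (Q w))
               (f : A → Carrier) x →
               when d ((∑[ w ∈ U ] when (e w) (f w)) * x) ≈ ∑[ w ∈ U ] when (d ×-dec e w) (f w * x)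
    when-*-∑ (no _)      U e f x = sym (∑-zero U)
    when-*-∑ (yes holds) U e f x = trans (*-distribʳ-∑ U _ x) (∑-cong U pointwise)
      where
      pointwise : ∀ w → when (e w) (f w) * x ≈ when (yes holds ×-dec e w) (f w * x)
      pointwise w with e w
      ... | yes _ = refl
      ... | no _  = zeroˡ x

    -- Antisymmetry only gives 2 · f z z ≈ 0, hence the separate diagonal hypothesis.
    ∑∑-antisymmetric : ∀ (U : List A) (f : A → A → Carrier) →
                       (∀ z w → f w z ≈ - f z w) → (∀ z → f z z ≈ 0#) →
                       ∑[ z ∈ U ] ∑[ w ∈ U ] f z w ≈ 0#
    ∑∑-antisymmetric []      f anti diag = refl
    ∑∑-antisymmetric (x ∷ U) f anti diag = begin
      (f x x + (∑[ w ∈ U ] f x w)) + (∑[ z ∈ U ] (f z x + (∑[ w ∈ U ] f z w)))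
        ≈⟨ +-cong (+-congʳ (diag x)) (∑-distrib-+ U (λ z → f z x) (λ z → ∑[ w ∈ U ] f z w)) ⟩
      (0# + (∑[ w ∈ U ] f x w)) + ((∑[ z ∈ U ] f z x) + (∑[ z ∈ U ] ∑[ w ∈ U ] f z w))
        ≈⟨ +-cong (+-identityˡ _) (+-cong (∑-cong U (anti x)) (∑∑-antisymmetric U f anti diag)) ⟩
      (∑[ w ∈ U ] f x w) + ((∑[ z ∈ U ] - f x z) + 0#)
        ≈⟨ +-congˡ (trans (+-identityʳ _) (∑-distrib-‿- U (f x))) ⟩
      (∑[ w ∈ U ] f x w) - (∑[ w ∈ U ] f x w)
        ≈⟨ -‿inverseʳ _ ⟩
      0# ∎


module ArrangementSums {c ℓ} (R : CommutativeRing c ℓ) where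
  open CommutativeRing R
  open FiniteSums R
  open Multisets ℕ._≟_
  open Terms R using (sumOver)
  open import Relation.Binary.Reasoning.Setoid setoid

  sum-remove : ∀ {z M} → z ∈ M → z ℕ.+ sum (remove z M) ≡ sum M
  sum-remove z∈ = ≡.sym (sum-↭ (↭-remove z∈))

  sumOver-reverse : ∀ (f : List ℕ → Carrier) C → sumOver f C ≈ ∑[ r ∈ map reverse C ] f (reverse r)
  sumOver-reverse f C = begin
    sumOver f C                           ≡⟨ sumOver≡∑ C ⟩
    ∑ C f                                 ≈⟨ ∑-cong C (reflexive ∘ ≡.cong f ∘ reverse-involutive) ⟨
    ∑[ c ∈ C ] f (reverse (reverse c))    ≡⟨ ∑-map reverse C (f ∘ reverse) ⟨
    ∑[ r ∈ map reverse C ] f (reverse r)  ∎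
    where
    sumOver≡∑ : ∀ C → sumOver f C ≡ ∑ C f
    sumOver≡∑ []      = ≡.refl
    sumOver≡∑ (c ∷ C) = ≡.cong (λ s → f c + s) (sumOver≡∑ C)

  HeadIn : List ℕ → List ℕ → Set
  HeadIn U []      = ⊥
  HeadIn U (x ∷ _) = x ∈ U

  ∑-by-head : ∀ {U} → Unique U → (g : List ℕ → Carrier) → ∀ C → All (HeadIn U) C →
              ∑ C g ≈ ∑[ z ∈ U ] ∑[ r ∈ derivative z C ] g (z ∷ r)
  ∑-by-head {U} uU g []            _              = sym (∑-zero U)
  ∑-by-head {U} uU g ((x ∷ r) ∷ C) (x∈U All.∷ hs) = begin
    g (x ∷ r) + ∑ C g
      ≈⟨ +-cong (∑-δ ℕ._≟_ uU x∈U (λ z → g (z ∷ r))) (sym (∑-by-head uU g C hs)) ⟨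
    (∑[ z ∈ U ] when (z ℕ.≟ x) (g (z ∷ r))) + (∑[ z ∈ U ] ∑[ s ∈ derivative z C ] g (z ∷ s))
      ≈⟨ ∑-distrib-+ U _ _ ⟨
    ∑[ z ∈ U ] (when (z ℕ.≟ x) (g (z ∷ r)) + (∑[ s ∈ derivative z C ] g (z ∷ s)))
      ≈⟨ ∑-cong U split ⟩
    ∑[ z ∈ U ] ∑[ s ∈ derivative z ((x ∷ r) ∷ C) ] g (z ∷ s) ∎
    where
    split : ∀ z → when (z ℕ.≟ x) (g (z ∷ r)) + (∑[ s ∈ derivative z C ] g (z ∷ s))
                ≈ ∑[ s ∈ derivative z ((x ∷ r) ∷ C) ] g (z ∷ s)
    split z with z ℕ.≟ x
    ... | yes ≡.refl = refl
    ... | no _       = +-identityˡ _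

  -- The first part z runs over a fixed index list U containing every part, with the indicator of
  -- z ∈ M, rather than over the distinct elements of M: double sums can then be interchanged freely.
  module _ (U : List ℕ) (σ : Carrier → Carrier) (h : Carrier → ℕ → ℕ → Carrier) where

    arrangementSum : ℕ → Carrier → List ℕ → Carrier
    arrangementSum zero    p M = 1#
    arrangementSum (suc n) p M =
      ∑[ z ∈ U ] when (z ∈? M) (arrangementSum n (σ p) (remove z M) * h p (sum (remove z M)) z)

    module _ (uU : Unique U) (F : Carrier → List ℕ → Carrier)
             (F-[] : ∀ p → F p [] ≈ 1#)
             (F-∷ : ∀ p z r → F p (z ∷ r) ≈ F (σ p) r * h p (sum r) z) where

      ∑-arrangements : ∀ n {μ C} p → length μ ≡ n → All (_∈ U) μ → Arrangements C μ →
                       ∑ C (F p) ≈ arrangementSum n p μ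
      ∑-arrangements zero {[]} p _ _ arr rewrite arrangements-[] arr = trans (+-identityʳ _) (F-[] p)
      ∑-arrangements (suc n) {μ} {C} p |μ| μ⊆U arr = begin
        ∑ C (F p)                                       ≈⟨ ∑-by-head uU (F p) C heads ⟩
        ∑[ z ∈ U ] ∑[ r ∈ derivative z C ] F p (z ∷ r)  ≈⟨ ∑-cong U by-head ⟩
        arrangementSum (suc n) p μ                      ∎
        where
        open Arrangements arr

        heads : All (HeadIn U) C
        heads = All.tabulate λ {c} c∈ → head c (∈⇒↭ c∈)
          where
          head : ∀ c → c ↭ μ → HeadIn U c
          head []      c↭ with () ← ≡.trans (↭-length c↭) |μ|
          head (x ∷ _) c↭ = All.lookup μ⊆U (∈-resp-↭ c↭ (here ≡.refl))

        by-head : ∀ z → ∑[ r ∈ derivative z C ] F p (z ∷ r)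
                      ≈ when (z ∈? μ) (arrangementSum n (σ p) (remove z μ) * h p (sum (remove z μ)) z)
        by-head z with z ∈? μ
        ... | no z∉μ  = trans (∑-cong-∈ D (λ r∈ → contradiction (∈-derivative⇒∈ arr r∈) z∉μ))
                              (∑-zero D)
          where D = derivative z C
        ... | yes z∈μ = begin
          ∑[ r ∈ D ] F p (z ∷ r)                           ≈⟨ ∑-cong D (F-∷ p z) ⟩
          ∑[ r ∈ D ] F (σ p) r * h p (sum r) z             ≈⟨ ∑-cong-∈ D (*-congˡ ∘ same-sum) ⟩
          ∑[ r ∈ D ] F (σ p) r * h p (sum (remove z μ)) z  ≈⟨ *-distribʳ-∑ D (F (σ p)) _ ⟨
          ∑ D (F (σ p)) * h p (sum (remove z μ)) z
            ≈⟨ *-congʳ (∑-arrangements n (σ p) |μ-z| μ-z⊆U arr′) ⟩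
          arrangementSum n (σ p) (remove z μ) * h p (sum (remove z μ)) z ∎
          where
          D = derivative z C
          arr′ = arrangements-derivative arr z∈μ

          same-sum : ∀ {r} → r ∈ D → h p (sum r) z ≈ h p (sum (remove z μ)) z
          same-sum r∈ = reflexive (≡.cong (λ t → h p t z) (sum-↭ (Arrangements.∈⇒↭ arr′ r∈)))

          |μ-z| : length (remove z μ) ≡ n
          |μ-z| = length-remove z∈μ |μ|

          μ-z⊆U : All (_∈ U) (remove z μ)
          μ-z⊆U = All.tabulate (All.lookup μ⊆U ∘ ∈-remove⁻ μ)

    arrangementSum-suc : (e : Carrier → ℕ → ℕ → Carrier) (k : ℕ → Carrier) →
                         (∀ p t z → h p t z ≈ e p t z * k (t ℕ.+ z)) → ∀ n p M →
                         arrangementSum (suc n) p M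
                           ≈ (∑[ z ∈ U ] when (z ∈? M)
                                (arrangementSum n (σ p) (remove z M) * e p (sum (remove z M)) z))
                             * k (sum M)
    arrangementSum-suc e k h≈e*k n p M = sym (trans (*-distribʳ-∑ U _ (k (sum M))) (∑-cong U pull-in))
      where
      pull-in : ∀ z → when (z ∈? M) (arrangementSum n (σ p) (remove z M) * e p (sum (remove z M)) z)
                      * k (sum M)
                    ≈ when (z ∈? M) (arrangementSum n (σ p) (remove z M) * h p (sum (remove z M)) z)
      pull-in z with z ∈? M
      ... | no _    = zeroˡ _
      ... | yes z∈M = begin
        (X * e p t z) * k (sum M)    ≡⟨ ≡.cong (λ s → (X * e p t z) * k s) t+z≡|M| ⟨
        (X * e p t z) * k (t ℕ.+ z)  ≈⟨ *-assoc _ _ _ ⟩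
        X * (e p t z * k (t ℕ.+ z))  ≈⟨ *-congˡ (h≈e*k p t z) ⟨
        X * h p t z                  ∎
        where
        X = arrangementSum n (σ p) (remove z M)
        t = sum (remove z M)
        t+z≡|M| : t ℕ.+ z ≡ sum M
        t+z≡|M| = ≡.trans (ℕ.+-comm t z) (sum-remove z∈M)


module Factors {c ℓ} (R : CommutativeRing c ℓ) (b q : CommutativeRing.Carrier R)
               (inv : ℕ → CommutativeRing.Carrier R) where
  open CommutativeRing R
  open RS (Semiring.rawSemiring semiring) using (_^_)
  open import Algebra.Properties.CommutativeSemiring.Exp commutativeSemiring using (^-homo-*; ^-distrib-*)
  open import Relation.Binary.Reasoning.Setoid setoid
  open Terms R using (lhsProd; rhsProd)

  lhsFactor rhsFactor : Carrier → ℕ → ℕ → Carrier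
  lhsFactor a t z = (a ^ z * q ^ t - b ^ z) * inv (t ℕ.+ z)
  rhsFactor a t z = (a ^ z - b ^ z) * inv (t ℕ.+ z)

  [xq]^w*q^t≈x^w*q^[w+t] : ∀ x w t → (x * q) ^ w * q ^ t ≈ x ^ w * q ^ (w ℕ.+ t)
  [xq]^w*q^t≈x^w*q^[w+t] x w t = begin
    (x * q) ^ w * q ^ t      ≈⟨ *-congʳ (^-distrib-* x q w) ⟩
    (x ^ w * q ^ w) * q ^ t  ≈⟨ *-assoc _ _ _ ⟩
    x ^ w * (q ^ w * q ^ t)  ≈⟨ *-congˡ (^-homo-* q w t) ⟨
    x ^ w * q ^ (w ℕ.+ t)    ∎

  lhsProd-∷ʳ : ∀ a s xs z →
               lhsProd a b q inv s (xs ∷ʳ z) ≈ lhsProd a b q inv s xs * lhsFactor a (s ℕ.+ sum xs) z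
  lhsProd-∷ʳ a s []       z rewrite ℕ.+-identityʳ s = trans (*-identityʳ _) (sym (*-identityˡ _))
  lhsProd-∷ʳ a s (x ∷ xs) z rewrite ≡.sym (ℕ.+-assoc s x (sum xs)) =
    trans (*-congˡ (lhsProd-∷ʳ a (s ℕ.+ x) xs z)) (sym (*-assoc _ _ _))

  rhsProd-∷ʳ : ∀ a s xs z →
               rhsProd a b q inv s (xs ∷ʳ z) ≈ rhsProd (a * q) b q inv s xs * rhsFactor a (s ℕ.+ sum xs) z
  rhsProd-∷ʳ a s []       z rewrite ℕ.+-identityʳ s =
    trans (*-identityʳ _) (trans (*-congʳ (+-congʳ (*-identityʳ _))) (sym (*-identityˡ _)))
  rhsProd-∷ʳ a s (x ∷ xs) z
    rewrite ≡.sym (ℕ.+-assoc s x (sum xs)) | length-++ xs {[ z ]} | ℕ.+-comm (length xs) 1 =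
    trans (*-cong (*-congʳ (+-congʳ (sym ([xq]^w*q^t≈x^w*q^[w+t] a x (length xs ℕ.* x)))))
                  (rhsProd-∷ʳ a (s ℕ.+ x) xs z))
          (sym (*-assoc _ _ _))


module SumIdentity {c ℓ} (R : CommutativeRing c ℓ) (b q : CommutativeRing.Carrier R)
                   (inv : ℕ → CommutativeRing.Carrier R) (U : List ℕ) where
  open CommutativeRing R
  open RS (Semiring.rawSemiring semiring) using (_^_)
  open import Relation.Binary.Reasoning.Setoid setoid
  open Terms R using (lhsProd; rhsProd; sumOver)
  open IntegerCoefficients R using (solve; _:+_; _:*_; _:-_; :-_; _:=_; con)
  open FiniteSums R
  open Multisets ℕ._≟_
  open ArrangementSums R
  open Factors R b q inv

  exchange : ∀ g u v x y Q i → g * (u - v) * (i * (x * Q - y))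
                               ≈ g * (u * Q - v) * (i * (x - y)) + i * (1# - Q) * (g * (x * v - u * y))
  exchange = solve 7 (λ g u v x y Q i →
    g :* (u :- v) :* (i :* (x :* Q :- y))
      := g :* (u :* Q :- v) :* (i :* (x :- y)) :+ i :* (con (ℤ.+ 1) :- Q) :* (g :* (x :* v :- u :* y)))
    refl

  x[y-z]≈-x[z-y] : ∀ x y z → x * (y - z) ≈ - (x * (z - y))
  x[y-z]≈-x[z-y] = solve 3 (λ x y z → x :* (y :- z) := :- (x :* (z :- y))) refl

  x[y-y]≈0 : ∀ x y → x * (y - y) ≈ 0#
  x[y-y]≈0 = solve 2 (λ x y → x :* (y :- y) := con (ℤ.+ 0)) refl

  lhsSum rhsSum : ℕ → Carrier → List ℕ → Carrier
  lhsSum = arrangementSum U (λ a → a) lhsFactor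
  rhsSum = arrangementSum U (_* q) rhsFactor

  lhsNumerator shiftedNumerator : ℕ → Carrier → List ℕ → Carrier
  lhsNumerator n a M =
    ∑[ z ∈ U ] when (z ∈? M) (lhsSum n a (remove z M) * (a ^ z * q ^ sum (remove z M) - b ^ z))
  shiftedNumerator n a M =
    ∑[ z ∈ U ] when (z ∈? M) (lhsSum n (a * q) (remove z M) * (a ^ z - b ^ z))

  lhsSum-suc : ∀ n a M → lhsSum (suc n) a M ≈ lhsNumerator n a M * inv (sum M)
  lhsSum-suc =
    arrangementSum-suc U (λ a → a) lhsFactor (λ a t z → a ^ z * q ^ t - b ^ z) inv (λ _ _ _ → refl)

  rhsSum-suc : ∀ n a M → rhsSum (suc n) a M
               ≈ (∑[ z ∈ U ] when (z ∈? M) (rhsSum n (a * q) (remove z M) * (a ^ z - b ^ z))) * inv (sum M)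
  rhsSum-suc = arrangementSum-suc U (_* q) rhsFactor (λ a t z → a ^ z - b ^ z) inv (λ _ _ _ → refl)

  lhsNumerator-shifted : ∀ n a M →
    lhsNumerator n (a * q) M
      ≈ ∑[ w ∈ U ] when (w ∈? M) (lhsSum n (a * q) (remove w M) * (a ^ w * q ^ sum M - b ^ w))
  lhsNumerator-shifted n a M = ∑-cong U λ w → when-cong (w ∈? M) λ w∈M → *-congˡ (+-congʳ (begin
    (a * q) ^ w * q ^ sum (remove w M)  ≈⟨ [xq]^w*q^t≈x^w*q^[w+t] a w (sum (remove w M)) ⟩
    a ^ w * q ^ (w ℕ.+ sum (remove w M)) ≡⟨ ≡.cong (λ k → a ^ w * q ^ k) (sum-remove w∈M) ⟩
    a ^ w * q ^ sum M                   ∎))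

  module LastTwoParts (m : ℕ) (a : Carrier) (M : List ℕ) where

    N : ℕ → List ℕ
    N z = remove z M

    Q I : ℕ → Carrier
    Q z = q ^ sum (N z)
    I z = inv (sum (N z))

    rest : ℕ → ℕ → Carrier
    rest z w = lhsSum m (a * q) (remove w (N z))

    pair : ∀ z w → Dec (z ∈ M × w ∈ N z)
    pair z w = z ∈? M ×-dec w ∈? N z

    unshifted shifted cross : ℕ → ℕ → Carrier
    unshifted z w = when (pair z w) (rest z w * (a ^ w - b ^ w) * (I z * (a ^ z * Q z - b ^ z)))
    shifted   z w = when (pair z w) (rest z w * (a ^ w * Q z - b ^ w) * (I z * (a ^ z - b ^ z)))
    cross     z w = when (pair z w) (rest z w * (a ^ z * b ^ w - a ^ w * b ^ z))

    expand-unshifted : (∀ {z} → z ∈ M → lhsNumerator m a (N z) ≈ shiftedNumerator m a (N z)) → ∀ z →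
                       when (z ∈? M) (lhsSum (suc m) a (N z) * (a ^ z * Q z - b ^ z))
                         ≈ ∑[ w ∈ U ] unshifted z w
    expand-unshifted numerator-shift z = trans (when-cong (z ∈? M) λ z∈M → begin
        lhsSum (suc m) a (N z) * E              ≈⟨ *-congʳ (lhsSum-suc m a (N z)) ⟩
        lhsNumerator m a (N z) * I z * E        ≈⟨ *-congʳ (*-congʳ (numerator-shift z∈M)) ⟩
        shiftedNumerator m a (N z) * I z * E    ≈⟨ *-assoc _ _ _ ⟩
        shiftedNumerator m a (N z) * (I z * E)  ∎)
      (when-*-∑ (z ∈? M) U (λ w → w ∈? N z) (λ w → rest z w * (a ^ w - b ^ w)) (I z * E))
      where E = a ^ z * Q z - b ^ z

    expand-shifted : ∀ z → when (z ∈? M) (lhsSum (suc m) (a * q) (N z) * (a ^ z - b ^ z))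
                             ≈ ∑[ w ∈ U ] shifted z w
    expand-shifted z = trans (when-cong (z ∈? M) λ z∈M → begin
        lhsSum (suc m) (a * q) (N z) * E        ≈⟨ *-congʳ (lhsSum-suc m (a * q) (N z)) ⟩
        lhsNumerator m (a * q) (N z) * I z * E  ≈⟨ *-congʳ (*-congʳ (lhsNumerator-shifted m a (N z))) ⟩
        X * I z * E                             ≈⟨ *-assoc _ _ _ ⟩
        X * (I z * E)                           ∎)
      (when-*-∑ (z ∈? M) U (λ w → w ∈? N z) (λ w → rest z w * (a ^ w * Q z - b ^ w)) (I z * E))
      where
      E = a ^ z - b ^ z
      X = ∑[ w ∈ U ] when (w ∈? N z) (rest z w * (a ^ w * Q z - b ^ w))

    unshifted≈shifted+cross : (∀ {z} → z ∈ M → I z * (1# - Q z) ≈ 1#) →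
                              ∀ z w → unshifted z w ≈ shifted z w + cross z w
    unshifted≈shifted+cross I[1-Q]≈1 z w = trans (when-cong (pair z w) λ (z∈M , _) →
        trans (exchange (rest z w) (a ^ w) (b ^ w) (a ^ z) (b ^ z) (Q z) (I z))
              (+-congˡ (trans (*-congʳ (I[1-Q]≈1 z∈M)) (*-identityˡ _))))
      (when-+ (pair z w) _ _)

    ∑∑-cross : ∑[ z ∈ U ] ∑[ w ∈ U ] cross z w ≈ 0#
    ∑∑-cross = ∑∑-antisymmetric U cross antisymmetric diagonal
      where
      antisymmetric : ∀ z w → cross w z ≈ - cross z w
      antisymmetric z w = begin
        cross w z
          ≡⟨ when-⇔ (mk⇔ ∈-remove-swap ∈-remove-swap) (pair w z) (pair z w) ⟩
        when (pair z w) (rest w z * (a ^ w * b ^ z - a ^ z * b ^ w))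
          ≡⟨ ≡.cong (λ X → when (pair z w) (lhsSum m (a * q) X * _)) (remove-comm z w M) ⟩
        when (pair z w) (rest z w * (a ^ w * b ^ z - a ^ z * b ^ w))
          ≈⟨ when-cong (pair z w) (λ _ → x[y-z]≈-x[z-y] _ _ _) ⟩
        when (pair z w) (- (rest z w * (a ^ z * b ^ w - a ^ w * b ^ z)))
          ≈⟨ when-‿- (pair z w) _ ⟩
        - cross z w ∎

      diagonal : ∀ z → cross z z ≈ 0#
      diagonal z = trans (when-cong (pair z z) (λ _ → x[y-y]≈0 _ _)) (when-0# (pair z z))

  Admissible : ℕ → List ℕ → Set
  Admissible S M = All (1 ≤_) M × sum M ≤ S

  admissible-remove : ∀ {S z M} → z ∈ M → Admissible S M → Admissible S (remove z M)
  admissible-remove {z = z} {M} z∈M (positive , ≤S) =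
    All.tabulate (All.lookup positive ∘ ∈-remove⁻ M) ,
    ℕ.≤-trans (ℕ.≤-trans (ℕ.m≤n+m _ z) (ℕ.≤-reflexive (sum-remove z∈M))) ≤S

  1≤sum : ∀ {N k} → All (1 ≤_) N → length N ≡ suc k → 1 ≤ sum N
  1≤sum {x ∷ N} (1≤x All.∷ _) _ = ℕ.≤-trans 1≤x (ℕ.m≤m+n x (sum N))

  module _ {S} (inv-spec : ∀ k → 1 ≤ k → k ≤ S → (1# - q ^ k) * inv k ≈ 1#) where

    numerator-shift : ∀ n M a → length M ≡ suc n → Admissible S M →
                      lhsNumerator n a M ≈ shiftedNumerator n a M
    numerator-shift zero M a |M| _ = ∑-cong U λ z → when-cong (z ∈? M) λ z∈M →
      *-congˡ (+-congʳ (trans (*-congˡ (reflexive (≡.cong (λ N → q ^ sum N) (remove-singleton z∈M))))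
                              (*-identityʳ _)))
      where
      remove-singleton : ∀ {z} → z ∈ M → remove z M ≡ []
      remove-singleton {z} z∈M with remove z M | length-remove z∈M |M|
      ... | [] | _ = ≡.refl
    numerator-shift (suc m) M a |M| adm = begin
      lhsNumerator (suc m) a M
        ≈⟨ ∑-cong U (expand-unshifted induction) ⟩
      ∑[ z ∈ U ] ∑[ w ∈ U ] unshifted z w
        ≈⟨ ∑-cong U (λ z → ∑-cong U (unshifted≈shifted+cross I[1-Q]≈1 z)) ⟩
      ∑[ z ∈ U ] ∑[ w ∈ U ] (shifted z w + cross z w)
        ≈⟨ ∑-cong U (λ z → ∑-distrib-+ U (shifted z) (cross z)) ⟩
      ∑[ z ∈ U ] ((∑[ w ∈ U ] shifted z w) + (∑[ w ∈ U ] cross z w))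
        ≈⟨ ∑-distrib-+ U _ _ ⟩
      (∑[ z ∈ U ] ∑[ w ∈ U ] shifted z w) + (∑[ z ∈ U ] ∑[ w ∈ U ] cross z w)
        ≈⟨ +-congˡ ∑∑-cross ⟩
      (∑[ z ∈ U ] ∑[ w ∈ U ] shifted z w) + 0#
        ≈⟨ +-identityʳ _ ⟩
      ∑[ z ∈ U ] ∑[ w ∈ U ] shifted z w
        ≈⟨ ∑-cong U expand-shifted ⟨
      shiftedNumerator (suc m) a M ∎
      where
      open LastTwoParts m a M

      induction : ∀ {z} → z ∈ M → lhsNumerator m a (N z) ≈ shiftedNumerator m a (N z)
      induction z∈M = numerator-shift m _ a (length-remove z∈M |M|) (admissible-remove z∈M adm)

      I[1-Q]≈1 : ∀ {z} → z ∈ M → I z * (1# - Q z) ≈ 1#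
      I[1-Q]≈1 {z} z∈M with positive , ≤S ← admissible-remove z∈M adm =
        trans (*-comm _ _) (inv-spec (sum (N z)) (1≤sum positive (length-remove z∈M |M|)) ≤S)

    lhsSum≈rhsSum : ∀ n M a → length M ≡ n → Admissible S M → lhsSum n a M ≈ rhsSum n a M
    lhsSum≈rhsSum zero    M a _   _   = refl
    lhsSum≈rhsSum (suc n) M a |M| adm = begin
      lhsSum (suc n) a M
        ≈⟨ lhsSum-suc n a M ⟩
      lhsNumerator n a M * inv (sum M)
        ≈⟨ *-congʳ (numerator-shift n M a |M| adm) ⟩
      shiftedNumerator n a M * inv (sum M)
        ≈⟨ *-congʳ (∑-cong U λ z → when-cong (z ∈? M) (*-congʳ ∘ induction)) ⟩
      (∑[ z ∈ U ] when (z ∈? M) (rhsSum n (a * q) (remove z M) * (a ^ z - b ^ z))) * inv (sum M)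
        ≈⟨ rhsSum-suc n a M ⟨
      rhsSum (suc n) a M ∎
      where
      induction : ∀ {z} → z ∈ M → lhsSum n (a * q) (remove z M) ≈ rhsSum n (a * q) (remove z M)
      induction {z} z∈M =
        lhsSum≈rhsSum n (remove z M) (a * q) (length-remove z∈M |M|) (admissible-remove z∈M adm)

  module _ (uU : Unique U) {μ C} (arr : Arrangements C μ) (μ⊆U : All (_∈ U) μ) where

    sumOver-lhsProd : ∀ a → sumOver (lhsProd a b q inv 0) C ≈ lhsSum (length μ) a μ
    sumOver-lhsProd a = trans (sumOver-reverse _ C)
      (∑-arrangements U (λ p → p) lhsFactor uU F (λ _ → refl) F-∷ (length μ) a ≡.refl μ⊆U
                      (arrangements-reverse arr))
      where
      F : Carrier → List ℕ → Carrier
      F p r = lhsProd p b q inv 0 (reverse r)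

      F-∷ : ∀ p z r → F p (z ∷ r) ≈ F p r * lhsFactor p (sum r) z
      F-∷ p z r rewrite unfold-reverse z r = trans (lhsProd-∷ʳ p 0 (reverse r) z)
        (reflexive (≡.cong (λ t → F p r * lhsFactor p t z) (sum-↭ (↭-reverse r))))

    sumOver-rhsProd : ∀ a → sumOver (rhsProd a b q inv 0) C ≈ rhsSum (length μ) a μ
    sumOver-rhsProd a = trans (sumOver-reverse _ C)
      (∑-arrangements U (_* q) rhsFactor uU F (λ _ → refl) F-∷ (length μ) a ≡.refl μ⊆U
                      (arrangements-reverse arr))
      where
      F : Carrier → List ℕ → Carrier
      F p r = rhsProd p b q inv 0 (reverse r)

      F-∷ : ∀ p z r → F p (z ∷ r) ≈ F (p * q) r * rhsFactor p (sum r) z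
      F-∷ p z r rewrite unfold-reverse z r = trans (rhsProd-∷ʳ p 0 (reverse r) z)
        (reflexive (≡.cong (λ t → F (p * q) r * rhsFactor p t z) (sum-↭ (↭-reverse r))))


∈⇒≤sum : ∀ {x xs} → x ∈ xs → x ≤ sum xs
∈⇒≤sum {xs = y ∷ xs} (here ≡.refl) = ℕ.m≤m+n y (sum xs)
∈⇒≤sum {xs = y ∷ xs} (there x∈)    = ℕ.≤-trans (∈⇒≤sum x∈) (ℕ.m≤n+m (sum xs) y)

mainTheorem9 : ∀ {c ℓ : Level} (R : CommutativeRing c ℓ) →
  let open CommutativeRing R
      open RS (Semiring.rawSemiring (CommutativeRing.semiring R)) using (_^_)
      open Terms R
  in (μ : List ℕ) → IsPartition μ → 1 ≤ length μ →
     (a b q : Carrier) (inv : ℕ → Carrier) →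
     (∀ k → 1 ≤ k → k ≤ sum μ → ((1# - q ^ k) * inv k ≈ 1#)) →
     (Cμ : List (List ℕ)) → Unique Cμ → (∀ w → (w ∈ Cμ) ⇔ (w ↭ μ)) →
     sumOver (lhsProd a b q inv 0) Cμ ≈ sumOver (rhsProd a b q inv 0) Cμ
mainTheorem9 R μ μ-partition _ a b q inv inv-spec Cμ unique ∈⇔↭ = begin
  sumOver (lhsProd a b q inv 0) Cμ  ≈⟨ sumOver-lhsProd U-unique arr μ⊆U a ⟩
  lhsSum (length μ) a μ             ≈⟨ lhsSum≈rhsSum inv-spec (length μ) μ a ≡.refl admissible ⟩
  rhsSum (length μ) a μ             ≈⟨ sumOver-rhsProd U-unique arr μ⊆U a ⟨
  sumOver (rhsProd a b q inv 0) Cμ  ∎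
  where
  open CommutativeRing R
  open Terms R
  open Multisets ℕ._≟_ using (Arrangements)
  open import Relation.Binary.Reasoning.Setoid setoid

  U : List ℕ
  U = upTo (suc (sum μ))

  open SumIdentity R b q inv U

  U-unique : Unique U
  U-unique = Unique.upTo⁺ (suc (sum μ))

  μ⊆U : All (_∈ U) μ
  μ⊆U = All.tabulate (λ x∈μ → ∈-upTo⁺ (ℕ.s≤s (∈⇒≤sum x∈μ)))

  arr : Arrangements Cμ μ
  arr = record { unique = unique ; ∈⇔↭ = ∈⇔↭ }

  admissible : Admissible (sum μ) μ
  admissible = IsPartition.positive μ-partition , ℕ.≤-refl
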